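{- For $n\geq 1$, $$Y_{n+1}(x)=2^n x A_n(x).$$
   Context: $A_n(x)=\sum_{\pi\in\mathfrak{S}_n}x^{{\rm des}(\pi)}$ where ${\rm des}(\pi)=\#\{i\in[n-1]:\pi(i)>\pi(i+1)\}$. Let $[n]_2=\{1,1,\ldots,n,n\}$. A Stirling permutation of order $k$ is a permutation of $[k]_2$ such that for each $i$ every entry between the two occurrences of $i$ is greater than $i$; $\mathcal{Q}_k$ denotes their set. For a word $\omega$, ${\rm red}(\omega)$ replaces each occurrence of the $i$th smallest distinct value by $i$. A Stirling permutation of the second kind of order $n$ is a permutation $\sigma$ of $[n]_2$ written as a nonempty disjoint union of cycles in standard cycle form such that: (i) the two copies of each $i\in[n]$ lie in the same cycle; (ii) each cycle is written with one of its smallest entries first and cycles are in increasing order of smallest entries; (iii) for each cycle $(c_1,\ldots,c_{2k})$, ${\rm red}(c_1\cdots c_{2k})\in\mathcal{Q}_k$. $\mathcal{Q}_n^2$ is the set of these. $\mathcal{CQ}_n\subseteq\mathcal{Q}_n^2$ is the set of those with exactly one cycle. For a cycle $(c_1,\ldots,c_{2k})$ with $k\ge2$, an entry $c_i$ with $2\le i\le 2k-1$ is a cycle ascent plateau if $c_{i-1}<c_i=c_{i+1}$; ${\rm cap}(\sigma)$ is the total number of cycle ascent plateaus of $\sigma$. $Y_n(x)=\sum_{\sigma\in\mathcal{CQ}_n}x^{{\rm cap}(\sigma)}$. -}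

module Defs where

open import Data.Nat using (ℕ; zero; suc; _+_; _*_; _^_; _<_; _<ᵇ_; _≡ᵇ_)
open import Data.Nat.Properties using (_≟_)
import Data.Nat.Properties as ℕP
open import Data.Bool using (Bool; true; false; if_then_else_; _∧_)
open import Data.List using (List; []; _∷_; [_]; length; map; filter; concatMap; upTo; lookup)
open import Data.Fin using (Fin; toℕ)
import Data.Fin as F
import Data.Fin.Properties as FP
open import Data.Empty using (⊥)
open import Relation.Nullary using (Dec; yes; no)
open import Relation.Nullary.Decidable using (_×-dec_; _→-dec_)
open import Relation.Binary.PropositionalEquality using (_≡_)
open import Data.Product using (_×_)

-- Polynomials with natural coefficients, represented by their coefficient
-- sequence: p j = coefficient of x^j.
Poly : Set
Poly = ℕ → ℕ

X*_ : Poly → Poly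
(X* p) zero    = 0
(X* p) (suc j) = p j

_·P_ : ℕ → Poly → Poly
(c ·P p) j = c * p j

words : ℕ → ℕ → List (List ℕ)
words zero    m = [ [] ]
words (suc k) m = concatMap (λ w → map (λ a → a ∷ w) (map suc (upTo m))) (words k m)

occ : ℕ → List ℕ → ℕ
occ i []      = 0
occ i (x ∷ w) = (if x ≡ᵇ i then 1 else 0) + occ i w

-- Permutations of [n] in one-line notation: words of length n over [n]
-- in which every i ∈ [n] occurs exactly once.
IsPerm : ℕ → List ℕ → Set
IsPerm n w = (i : Fin n) → occ (suc (toℕ i)) w ≡ 1

-- Words over [n] in which every i ∈ [n] occurs exactly twice
-- (i.e. permutations of the multiset [n]_2 when the length is 2n).
IsPerm2 : ℕ → List ℕ → Set
IsPerm2 n w = (i : Fin n) → occ (suc (toℕ i)) w ≡ 2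

Stirling : List ℕ → Set
Stirling w = (a b c : Fin (length w)) → a F.< b → b F.< c →
             lookup w a ≡ lookup w c → lookup w a < lookup w b

-- The first letter is 1 (standard cycle form of a single cycle on [n]_2).
FirstIsOne : List ℕ → Set
FirstIsOne []      = ⊥
FirstIsOne (x ∷ _) = x ≡ 1

des : List ℕ → ℕ
des (x ∷ y ∷ r) = (if y <ᵇ x then 1 else 0) + des (y ∷ r)
des _           = 0

-- cycle ascent plateaus of a cycle (c₁,…,c_{2k}) written as the word c₁⋯c_{2k}:
-- positions 2 ≤ i ≤ 2k-1 with c_{i-1} < c_i = c_{i+1}
cap : List ℕ → ℕ
cap (a ∷ b ∷ c ∷ r) = (if (a <ᵇ b) ∧ (b ≡ᵇ c) then 1 else 0) + cap (b ∷ c ∷ r)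
cap _               = 0

IsPerm? : ∀ n w → Dec (IsPerm n w)
IsPerm? n w = FP.all? (λ i → occ (suc (toℕ i)) w ≟ 1)

IsPerm2? : ∀ n w → Dec (IsPerm2 n w)
IsPerm2? n w = FP.all? (λ i → occ (suc (toℕ i)) w ≟ 2)

Stirling? : ∀ w → Dec (Stirling w)
Stirling? w = FP.all? λ a → FP.all? λ b → FP.all? λ c →
  (a FP.<? b) →-dec ((b FP.<? c) →-dec
    ((lookup w a ≟ lookup w c) →-dec (lookup w a ℕP.<? lookup w b)))

FirstIsOne? : ∀ w → Dec (FirstIsOne w)
FirstIsOne? []      = no (λ ())
FirstIsOne? (x ∷ _) = x ≟ 1

-- 𝔖_n (as words) and 𝒞𝒬_n (single-cycle Stirling permutations of the second
-- kind of order n, identified with the word c₁⋯c_{2n} of the cycle, c₁ = 1).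
Sym : ℕ → List (List ℕ)
Sym n = filter (IsPerm? n) (words n n)

CQ : ℕ → List (List ℕ)
CQ n = filter (λ w → IsPerm2? n w ×-dec (Stirling? w ×-dec FirstIsOne? w)) (words (2 * n) n)

A : ℕ → Poly
A n j = length (filter (λ w → des w ≟ j) (Sym n))

Y : ℕ → Poly
Y n j = length (filter (λ w → cap w ≟ j) (CQ n))

module Submission where

-- Both polynomials are computed by inserting the largest letter.  Every
-- σ ∈ 𝒞𝒬_{n+1} arises from exactly one τ ∈ 𝒞𝒬_n (erase both copies of n+1) by
-- inserting the plateau (n+1)(n+1) right after one of the 2n entries of τ;
-- such an insertion keeps cap iff it splits an existing plateau, which happens
-- for exactly 2·cap τ of them, and otherwise raises cap by one.  Likewise every
-- π ∈ 𝔖_{n+1} arises from exactly one π' ∈ 𝔖_n by inserting n+1 into one of its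
-- n+1 gaps, des π' + 1 of which keep des.  A general counting principle
-- (InsertionRecurrence) turns such a description into the recurrences
--   Y_{n+1,k+1} = (2k+2) Y_{n,k+1} + (2n-2k) Y_{n,k},  Y_{n+1,0} = 0,
--   A_{n+1,k+1} = (k+2) A_{n,k+1} + (n-k) A_{n,k},     A_{n+1,0} = A_{n,0},
-- so Y_{n+1}(x)/x and 2ⁿ A_n(x) satisfy the same recurrence; since Y_2(x) = 2x
-- the theorem follows by induction on n.

open import Defs
open import Data.Nat using (ℕ; zero; suc; _+_; _*_; _∸_; _^_; _≤_; _<_; z≤n; s≤s; _≡ᵇ_; _<ᵇ_)
open import Data.Nat.Properties as ℕP using (_≟_)
open import Data.Bool using (Bool; true; false; if_then_else_; not; T; _∧_; _∨_)
open import Data.Bool.Properties using (∧-zeroʳ)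
open import Data.Empty using (⊥-elim)
open import Data.List using (List; []; _∷_; _++_; length; map; filter; concatMap; upTo; drop; lookup; replicate)
open import Data.List.Properties using (map-∘; map-cong; map-cong-local; map-++; ∷-injectiveˡ; ∷-injectiveʳ; ++-identityʳ; length-++; length-replicate; filter-++; filter-all; filter-none; filter-accept; filter-reject)
open import Data.Nat.ListAction using (sum)
open import Data.Nat.ListAction.Properties using (sum-++; sum-↭)
open import Data.Nat.Tactic.RingSolver using (solve-∀)
open import Data.List.Membership.Propositional using (_∈_; _∉_; find; lose)
open import Data.List.Membership.Propositional.Properties using (∈-concatMap⁺; ∈-concatMap⁻; ∈-map⁺; ∈-map⁻; ∈-upTo⁺; ∈-upTo⁻; ∈-lookup; ∈-filter⁻; ∈-filter⁺; ∈-++⁺ˡ; ∈-++⁺ʳ; ∈-++⁻)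
open import Data.List.Membership.Propositional.Properties.WithK using (unique∧set⇒bag)
open import Data.List.Relation.Unary.Any as Any using (here; there)
open import Data.List.Relation.Unary.All as All using (All; []; _∷_)
import Data.List.Relation.Unary.All.Properties as AllP
open import Data.List.Relation.Unary.All.Properties using (¬Any⇒All¬)
open import Data.List.Relation.Unary.Unique.Propositional using (Unique)
import Data.List.Relation.Unary.Unique.Propositional.Properties as Unique
open import Data.List.Relation.Unary.AllPairs using ([]; _∷_)
open import Data.List.Relation.Binary.Permutation.Propositional using (_↭_)
import Data.List.Relation.Binary.Permutation.Propositional.Properties as ↭
open import Data.List.Relation.Binary.BagAndSetEquality using (∼bag⇒↭)
open import Data.Product using (∃; ∃₂; _×_; _,_; proj₁; proj₂)
open import Data.Sum using (inj₁; inj₂)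
open import Data.Fin as F using (Fin)
import Data.Fin.Properties as FP
open import Data.Unit using (⊤; tt)
open import Function using (_∘_)
open import Function.Bundles using (mk⇔)
open import Relation.Nullary using (Dec; yes; no; does; ¬_; ¬?)
open import Relation.Nullary.Decidable using (_×-dec_)
open import Relation.Binary.PropositionalEquality

ind : Bool → ℕ
ind b = if b then 1 else 0

δ : ℕ → ℕ → ℕ
δ i j = ind (does (i ≟ j))

count : {A : Set} → (A → Bool) → List A → ℕ
count p xs = sum (map (ind ∘ p) xs)

countAt : {A : Set} → (A → ℕ) → ℕ → List A → ℕ
countAt s j = count (λ x → does (s x ≟ j))

length-filter : {A : Set} {P : A → Set} (P? : (x : A) → Dec (P x)) (xs : List A) →
                length (filter P? xs) ≡ count (does ∘ P?) xs
length-filter P? [] = refl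
length-filter P? (x ∷ xs) with does (P? x)
... | true  = cong suc (length-filter P? xs)
... | false = length-filter P? xs

count-↭ : {A : Set} (p : A → Bool) {xs ys : List A} → xs ↭ ys → count p xs ≡ count p ys
count-↭ p xs↭ys = sum-↭ (↭.map⁺ (ind ∘ p) xs↭ys)

count-map : {A B : Set} (p : B → Bool) (f : A → B) (xs : List A) → count p (map f xs) ≡ count (p ∘ f) xs
count-map p f xs = cong sum (sym (map-∘ xs))

count-concatMap : {A B : Set} (p : B → Bool) (f : A → List B) (xs : List A) →
                  count p (concatMap f xs) ≡ sum (map (count p ∘ f) xs)
count-concatMap p f [] = refl
count-concatMap p f (x ∷ xs) = begin
  sum (map (ind ∘ p) (f x ++ concatMap f xs))          ≡⟨ cong sum (map-++ (ind ∘ p) (f x) _) ⟩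
  sum (map (ind ∘ p) (f x) ++ map (ind ∘ p) (concatMap f xs)) ≡⟨ sum-++ (map (ind ∘ p) (f x)) _ ⟩
  count p (f x) + count p (concatMap f xs)             ≡⟨ cong (count p (f x) +_) (count-concatMap p f xs) ⟩
  count p (f x) + sum (map (count p ∘ f) xs)            ∎
  where open ≡-Reasoning

sum-δ : {A : Set} (s : A → ℕ) (f : ℕ → ℕ) (j : ℕ) (xs : List A) →
        sum (map (λ x → δ (s x) j * f (s x)) xs) ≡ f j * countAt s j xs
sum-δ s f j [] = sym (ℕP.*-zeroʳ (f j))
sum-δ s f j (x ∷ xs) =
  trans (cong₂ _+_ (term (s x ≟ j)) (sum-δ s f j xs)) (sym (ℕP.*-distribˡ-+ (f j) _ _))
  where
    term : (d : Dec (s x ≡ j)) → ind (does d) * f (s x) ≡ f j * ind (does d)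
    term (yes refl) = ℕP.*-comm 1 (f (s x))
    term (no _)     = sym (ℕP.*-zeroʳ (f j))

sum-zeros : {A : Set} (xs : List A) → sum (map (λ _ → 0) xs) ≡ 0
sum-zeros []       = refl
sum-zeros (_ ∷ xs) = sum-zeros xs

sum-map-+ : {A : Set} (f g : A → ℕ) (xs : List A) →
            sum (map (λ x → f x + g x) xs) ≡ sum (map f xs) + sum (map g xs)
sum-map-+ f g [] = refl
sum-map-+ f g (x ∷ xs) = trans (cong (f x + g x +_) (sum-map-+ f g xs)) (shuffle (f x) (g x) _ _)
  where
    shuffle : ∀ a b c d → a + b + (c + d) ≡ a + c + (b + d)
    shuffle = solve-∀

-- An insertion into a word either keeps a statistic with value c (flag true)
-- or raises it to c + 1 (flag false).
bump : ℕ → Bool → ℕ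
bump c true  = c
bump c false = suc c

trues falses : List Bool → ℕ
trues  = count (λ b → b)
falses = count not

trues+falses : (fl : List Bool) → trues fl + falses fl ≡ length fl
trues+falses []           = refl
trues+falses (true ∷ fl)  = cong suc (trues+falses fl)
trues+falses (false ∷ fl) = trans (ℕP.+-suc _ _) (cong suc (trues+falses fl))

countAt-bump : (c j : ℕ) (fl : List Bool) →
               countAt (bump c) j fl ≡ δ c j * trues fl + δ (suc c) j * falses fl
countAt-bump c j [] = sym (cong₂ _+_ (ℕP.*-zeroʳ (δ c j)) (ℕP.*-zeroʳ (δ (suc c) j)))
countAt-bump c j (true ∷ fl) =
  trans (cong (δ c j +_) (countAt-bump c j fl)) (keep (δ c j) (trues fl) (δ (suc c) j) (falses fl))
  where
    keep : ∀ a t b f → a + (a * t + b * f) ≡ a * suc t + b * f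
    keep = solve-∀
countAt-bump c j (false ∷ fl) =
  trans (cong (δ (suc c) j +_) (countAt-bump c j fl)) (raise (δ c j) (trues fl) (δ (suc c) j) (falses fl))
  where
    raise : ∀ a t b f → b + (a * t + b * f) ≡ a * t + b * suc f
    raise = solve-∀

module InsertionRecurrence
  {W : Set} (s : W → ℕ) (α : ℕ → ℕ) (L : ℕ)
  (S S' : List W) (ins : W → List W) (keep : W → List Bool)
  (S'↭fibres  : S' ↭ concatMap ins S)
  (fibre-stat : ∀ {τ} → τ ∈ S → map s (ins τ) ≡ map (bump (s τ)) (keep τ))
  (keep-trues : ∀ {τ} → τ ∈ S → trues (keep τ) ≡ α (s τ))
  (keep-len   : ∀ {τ} → τ ∈ S → length (keep τ) ≡ L)
  where

  falses-keep : ∀ {τ} → τ ∈ S → falses (keep τ) ≡ L ∸ α (s τ)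
  falses-keep {τ} τ∈S = begin
    falses (keep τ)                              ≡⟨ sym (ℕP.m+n∸m≡n (trues (keep τ)) _) ⟩
    trues (keep τ) + falses (keep τ) ∸ trues (keep τ) ≡⟨ cong₂ _∸_ (trans (trues+falses (keep τ)) (keep-len τ∈S)) (keep-trues τ∈S) ⟩
    L ∸ α (s τ)                                  ∎
    where open ≡-Reasoning

  countAt-fibre : ∀ j {τ} → τ ∈ S →
                  countAt s j (ins τ) ≡ δ (s τ) j * α (s τ) + δ (suc (s τ)) j * (L ∸ α (s τ))
  countAt-fibre j {τ} τ∈S = begin
    countAt s j (ins τ)                                  ≡⟨ sym (count-map _ s (ins τ)) ⟩
    countAt (λ v → v) j (map s (ins τ))                  ≡⟨ cong (countAt (λ v → v) j) (fibre-stat τ∈S) ⟩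
    countAt (λ v → v) j (map (bump (s τ)) (keep τ))      ≡⟨ count-map _ (bump (s τ)) (keep τ) ⟩
    countAt (bump (s τ)) j (keep τ)                      ≡⟨ countAt-bump (s τ) j (keep τ) ⟩
    δ (s τ) j * trues (keep τ) + δ (suc (s τ)) j * falses (keep τ)
      ≡⟨ cong₂ (λ t f → δ (s τ) j * t + δ (suc (s τ)) j * f) (keep-trues τ∈S) (falses-keep τ∈S) ⟩
    δ (s τ) j * α (s τ) + δ (suc (s τ)) j * (L ∸ α (s τ)) ∎
    where open ≡-Reasoning

  raised : ℕ → ℕ
  raised j = sum (map (λ τ → δ (suc (s τ)) j * (L ∸ α (s τ))) S)

  countAt-S' : ∀ j → countAt s j S' ≡ α j * countAt s j S + raised j
  countAt-S' j = begin
    countAt s j S'                               ≡⟨ count-↭ _ S'↭fibres ⟩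
    countAt s j (concatMap ins S)                ≡⟨ count-concatMap _ ins S ⟩
    sum (map (countAt s j ∘ ins) S)              ≡⟨ cong sum (map-cong-local (All.tabulate (countAt-fibre j))) ⟩
    sum (map (λ τ → δ (s τ) j * α (s τ) + δ (suc (s τ)) j * (L ∸ α (s τ))) S)
      ≡⟨ sum-map-+ _ _ S ⟩
    sum (map (λ τ → δ (s τ) j * α (s τ)) S) + raised j
      ≡⟨ cong (_+ raised j) (sum-δ s α j S) ⟩
    α j * countAt s j S + raised j               ∎
    where open ≡-Reasoning

  recurrence-zero : countAt s 0 S' ≡ α 0 * countAt s 0 S
  recurrence-zero =
    trans (countAt-S' 0) (trans (cong (α 0 * countAt s 0 S +_) (sum-zeros S)) (ℕP.+-identityʳ _))

  recurrence-suc : ∀ k → countAt s (suc k) S' ≡ α (suc k) * countAt s (suc k) S + (L ∸ α k) * countAt s k S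
  recurrence-suc k =
    trans (countAt-S' (suc k)) (cong (α (suc k) * countAt s (suc k) S +_) (sum-δ s (λ c → L ∸ α c) k S))

-- Decomposing a list into fibres.  If del is a left inverse of ins on S, the
-- fibres are pairwise disjoint, so their concatenation has no repetitions.
concatMap-unique : {W : Set} (ins : W → List W) (del : W → W) {S : List W} →
                   Unique S → (∀ {τ} → τ ∈ S → Unique (ins τ)) →
                   (∀ {τ z} → τ ∈ S → z ∈ ins τ → del z ≡ τ) →
                   Unique (concatMap ins S)
concatMap-unique ins del {[]} _ _ _ = []
concatMap-unique ins del {τ ∷ S} (τ∉S ∷ uS) uIns del-ins =
  Unique.++⁺ (uIns (here refl)) (concatMap-unique ins del uS (uIns ∘ there) (del-ins ∘ there)) disjoint
  where
    disjoint : ∀ {z} → ¬ (z ∈ ins τ × z ∈ concatMap ins S)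
    disjoint (z∈τ , z∈rest) =
      let (σ , σ∈S , z∈σ) = find (∈-concatMap⁻ ins z∈rest)
      in All.lookup τ∉S σ∈S (trans (sym (del-ins (here refl) z∈τ)) (del-ins (there σ∈S) z∈σ))

fibres-↭ : {W : Set} (ins : W → List W) (del : W → W) {S S' : List W} →
           Unique S → Unique S' → (∀ {τ} → τ ∈ S → Unique (ins τ)) →
           (∀ {τ z} → τ ∈ S → z ∈ ins τ → del z ≡ τ × z ∈ S') →
           (∀ {z} → z ∈ S' → del z ∈ S × z ∈ ins (del z)) →
           S' ↭ concatMap ins S
fibres-↭ ins del uS uS' uIns into onto =
  ∼bag⇒↭ (unique∧set⇒bag uS' (concatMap-unique ins del uS uIns (λ τ∈S → proj₁ ∘ into τ∈S))
    (mk⇔ (λ z∈S' → let (del∈S , z∈fibre) = onto z∈S' in ∈-concatMap⁺ ins (lose del∈S z∈fibre))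
         (λ z∈cm → let (τ , τ∈S , z∈τ) = find (∈-concatMap⁻ ins z∈cm) in proj₂ (into τ∈S z∈τ))))

Letter : ℕ → ℕ → Set
Letter m a = 1 ≤ a × a ≤ m

extensions : ℕ → List ℕ → List (List ℕ)
extensions m w = map (λ a → a ∷ w) (map suc (upTo m))

∈-alphabet⁻ : ∀ {m a} → a ∈ map suc (upTo m) → Letter m a
∈-alphabet⁻ a∈ with ∈-map⁻ suc a∈
... | _ , b∈ , refl = s≤s z≤n , ∈-upTo⁻ b∈

∈-alphabet⁺ : ∀ {m a} → Letter m a → a ∈ map suc (upTo m)
∈-alphabet⁺ {a = suc b} (s≤s z≤n , b<m) = ∈-map⁺ suc (∈-upTo⁺ b<m)

words⁻ : ∀ k m {w} → w ∈ words k m → length w ≡ k × All (Letter m) w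
words⁻ zero    m (here refl) = refl , []
words⁻ (suc k) m w∈ with find (∈-concatMap⁻ (extensions m) {words k m} w∈)
... | w' , w'∈ , w∈ext with ∈-map⁻ (λ a → a ∷ w') w∈ext
... | a , a∈ , refl =
  let (len , letters) = words⁻ k m w'∈ in cong suc len , ∈-alphabet⁻ a∈ ∷ letters

words⁺ : ∀ m {w} → All (Letter m) w → w ∈ words (length w) m
words⁺ m []                    = here refl
words⁺ m {a ∷ w} (a∈ ∷ letters) =
  ∈-concatMap⁺ (extensions m) {words (length w) m} (lose (words⁺ m letters) (∈-map⁺ (λ b → b ∷ w) (∈-alphabet⁺ a∈)))

words-unique : ∀ k m → Unique (words k m)
words-unique zero    m = [] ∷ []
words-unique (suc k) m =
  concatMap-unique (extensions m) (drop 1) {words k m} (words-unique k m)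
    (λ _ → Unique.map⁺ ∷-injectiveˡ (Unique.map⁺ ℕP.suc-injective (Unique.upTo⁺ m)))
    drop-extension
  where
    drop-extension : ∀ {w z} → w ∈ words k m → z ∈ extensions m w → drop 1 z ≡ w
    drop-extension {w} _ z∈ with ∈-map⁻ (λ a → a ∷ w) z∈
    ... | _ , _ , refl = refl

-- The Stirling condition of Defs, in an equivalent recursive form that is
-- easier to transport along erasure and insertion.

AboveUntil : ℕ → List ℕ → Set
AboveUntil x []      = ⊤
AboveUntil x (y ∷ w) = (x ∈ w → x < y) × AboveUntil x w

Stirlingʳ : List ℕ → Set
Stirlingʳ []      = ⊤
Stirlingʳ (x ∷ w) = AboveUntil x w × Stirlingʳ w

AboveUntilᵖ : ℕ → List ℕ → Set
AboveUntilᵖ x w = (b c : Fin (length w)) → b F.< c → lookup w c ≡ x → x < lookup w b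

AboveUntilᵖ⇒AboveUntil : ∀ x w → AboveUntilᵖ x w → AboveUntil x w
AboveUntilᵖ⇒AboveUntil x []      _ = tt
AboveUntilᵖ⇒AboveUntil x (y ∷ w) h =
  (λ x∈w → let (c , w[c]≡x) = index x∈w in h F.zero (F.suc c) (s≤s z≤n) w[c]≡x) ,
  AboveUntilᵖ⇒AboveUntil x w (λ b c b<c → h (F.suc b) (F.suc c) (s≤s b<c))
  where
    index : ∀ {x} {w : List ℕ} → x ∈ w → ∃ λ c → lookup w c ≡ x
    index (here refl) = F.zero , refl
    index (there x∈w) = let (c , eq) = index x∈w in F.suc c , eq

AboveUntil⇒AboveUntilᵖ : ∀ x w → AboveUntil x w → AboveUntilᵖ x w
AboveUntil⇒AboveUntilᵖ x (y ∷ w) (h , _) F.zero    (F.suc c) _         w[c]≡x =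
  h (subst (_∈ w) w[c]≡x (∈-lookup c))
AboveUntil⇒AboveUntilᵖ x (y ∷ w) (_ , a) (F.suc b) (F.suc c) (s≤s b<c) w[c]≡x =
  AboveUntil⇒AboveUntilᵖ x w a b c b<c w[c]≡x

Stirling⇒Stirlingʳ : ∀ w → Stirling w → Stirlingʳ w
Stirling⇒Stirlingʳ []      _ = tt
Stirling⇒Stirlingʳ (x ∷ w) h =
  AboveUntilᵖ⇒AboveUntil x w (λ b c b<c eq → h F.zero (F.suc b) (F.suc c) (s≤s z≤n) (s≤s b<c) (sym eq)) ,
  Stirling⇒Stirlingʳ w (λ a b c a<b b<c → h (F.suc a) (F.suc b) (F.suc c) (s≤s a<b) (s≤s b<c))

Stirlingʳ⇒Stirling : ∀ w → Stirlingʳ w → Stirling w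
Stirlingʳ⇒Stirling (x ∷ w) (a , _) F.zero    (F.suc b) (F.suc c) _         (s≤s b<c) eq =
  AboveUntil⇒AboveUntilᵖ x w a b c b<c (sym eq)
Stirlingʳ⇒Stirling (x ∷ w) (_ , s) (F.suc a) (F.suc b) (F.suc c) (s≤s a<b) (s≤s b<c) eq =
  Stirlingʳ⇒Stirling w s a b c a<b b<c eq

≡ᵇ-refl : ∀ m → (m ≡ᵇ m) ≡ true
≡ᵇ-refl zero    = refl
≡ᵇ-refl (suc m) = ≡ᵇ-refl m

≢⇒≡ᵇ-false : ∀ {x i} → x ≢ i → (x ≡ᵇ i) ≡ false
≢⇒≡ᵇ-false {x} {i} x≢i with x ≡ᵇ i in eq
... | true  = ⊥-elim (x≢i (ℕP.≡ᵇ⇒≡ x i (subst T (sym eq) tt)))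
... | false = refl

occ-++ : ∀ i u v → occ i (u ++ v) ≡ occ i u + occ i v
occ-++ i []      v = refl
occ-++ i (x ∷ u) v = trans (cong (ind (x ≡ᵇ i) +_) (occ-++ i u v)) (sym (ℕP.+-assoc (ind (x ≡ᵇ i)) (occ i u) (occ i v)))

∉⇒occ≡0 : ∀ {i} w → i ∉ w → occ i w ≡ 0
∉⇒occ≡0 []      _   = refl
∉⇒occ≡0 (x ∷ w) i∉w rewrite ≢⇒≡ᵇ-false (λ x≡i → i∉w (here (sym x≡i))) = ∉⇒occ≡0 w (i∉w ∘ there)

occ≡0⇒∉ : ∀ {i} w → occ i w ≡ 0 → i ∉ w
occ≡0⇒∉ {i} (x ∷ w) occ≡0 (here refl) rewrite ≡ᵇ-refl i with occ≡0
... | ()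
occ≡0⇒∉ {i} (x ∷ w) occ≡0 (there i∈w) with x ≡ᵇ i
... | false = occ≡0⇒∉ w occ≡0 i∈w

occ-replicate : ∀ c m → occ m (replicate c m) ≡ c
occ-replicate zero    m = refl
occ-replicate (suc c) m rewrite ≡ᵇ-refl m = cong suc (occ-replicate c m)

occ-replicate-other : ∀ {i m} c → i ≢ m → occ i (replicate c m) ≡ 0
occ-replicate-other zero    _   = refl
occ-replicate-other (suc c) i≢m rewrite ≢⇒≡ᵇ-false (i≢m ∘ sym) = occ-replicate-other c i≢m

erase : ℕ → List ℕ → List ℕ
erase m = filter (λ x → ¬? (x ≟ m))

erase-∉ : ∀ {m w} → m ∉ w → erase m w ≡ w
erase-∉ {m} m∉w = filter-all (λ x → ¬? (x ≟ m)) (¬Any⇒All¬ _ (λ m∈w → m∉w (Any.map sym m∈w)))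

erase-replicate : ∀ c m → erase m (replicate c m) ≡ []
erase-replicate c m = filter-none (λ x → ¬? (x ≟ m)) (AllP.replicate⁺ c (λ m≢m → m≢m refl))

∈-erase⁻ : ∀ {m y} w → y ∈ erase m w → y ∈ w × y ≢ m
∈-erase⁻ w = ∈-filter⁻ (λ x → ¬? (x ≟ _))

erase-keep : ∀ {m x} w → x ≢ m → erase m (x ∷ w) ≡ x ∷ erase m w
erase-keep {m} w x≢m = filter-accept (λ y → ¬? (y ≟ m)) x≢m

erase-drop : ∀ m w → erase m (m ∷ w) ≡ erase m w
erase-drop m w = filter-reject (λ y → ¬? (y ≟ m)) (λ m≢m → m≢m refl)

occ-erase : ∀ {i m} w → i ≢ m → occ i (erase m w) ≡ occ i w
occ-erase []      _   = refl
occ-erase {i} {m} (x ∷ w) i≢m with x ≟ m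
... | yes refl rewrite erase-drop m w | ≢⇒≡ᵇ-false (i≢m ∘ sym) = occ-erase w i≢m
... | no x≢m   rewrite erase-keep w x≢m = cong (ind (x ≡ᵇ i) +_) (occ-erase w i≢m)

length-erase : ∀ m w → length (erase m w) + occ m w ≡ length w
length-erase m []      = refl
length-erase m (x ∷ w) with x ≟ m
... | yes refl rewrite erase-drop m w | ≡ᵇ-refl m = trans (ℕP.+-suc _ _) (cong suc (length-erase m w))
... | no x≢m   rewrite erase-keep w x≢m | ≢⇒≡ᵇ-false x≢m = cong suc (length-erase m w)

insertions : List ℕ → List ℕ → List (List ℕ)
insertions b []      = b ∷ []
insertions b (x ∷ w) = (b ++ x ∷ w) ∷ map (x ∷_) (insertions b w)

insertions⁻ : ∀ b w {z} → z ∈ insertions b w → ∃₂ λ u v → w ≡ u ++ v × z ≡ u ++ b ++ v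
insertions⁻ b []      (here refl) = [] , [] , refl , sym (++-identityʳ b)
insertions⁻ b (x ∷ w) (here refl) = [] , x ∷ w , refl , refl
insertions⁻ b (x ∷ w) (there z∈) with ∈-map⁻ (x ∷_) z∈
... | z' , z'∈ , refl with insertions⁻ b w z'∈
...   | u , v , refl , refl = x ∷ u , v , refl , refl

insertions⁺ : ∀ b u v → u ++ b ++ v ∈ insertions b (u ++ v)
insertions⁺ b []      []      = here (++-identityʳ b)
insertions⁺ b []      (x ∷ v) = here refl
insertions⁺ b (x ∷ u) v       = there (∈-map⁺ (x ∷_) (insertions⁺ b u v))

insertions-unique : ∀ {m} b w → m ∉ w → Unique (insertions (m ∷ b) w)
insertions-unique b []      _   = [] ∷ []
insertions-unique {m} b (x ∷ w) m∉ =
  All.tabulate head-differs ∷ Unique.map⁺ ∷-injectiveʳ (insertions-unique b w (m∉ ∘ there))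
  where
    head-differs : ∀ {z} → z ∈ map (x ∷_) (insertions (m ∷ b) w) → m ∷ b ++ x ∷ w ≢ z
    head-differs z∈ eq with ∈-map⁻ (x ∷_) z∈
    ... | _ , _ , refl = m∉ (here (∷-injectiveˡ eq))

additive-insertion : (f : List ℕ → ℕ) → (∀ u v → f (u ++ v) ≡ f u + f v) →
                     ∀ u b v → f (u ++ b ++ v) ≡ f b + f (u ++ v)
additive-insertion f f-++ u b v = begin
  f (u ++ b ++ v)       ≡⟨ trans (f-++ u (b ++ v)) (cong (f u +_) (f-++ b v)) ⟩
  f u + (f b + f v)     ≡⟨ swap (f u) (f b) (f v) ⟩
  f b + (f u + f v)     ≡⟨ cong (f b +_) (sym (f-++ u v)) ⟩
  f b + f (u ++ v)      ∎
  where
    open ≡-Reasoning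
    swap : ∀ a b c → a + (b + c) ≡ b + (a + c)
    swap = solve-∀

erase-insertion : ∀ c m u v → m ∉ u ++ v → erase m (u ++ replicate c m ++ v) ≡ u ++ v
erase-insertion c m u v m∉ = begin
  erase m (u ++ replicate c m ++ v)                     ≡⟨ filter-++ P? u _ ⟩
  erase m u ++ erase m (replicate c m ++ v)             ≡⟨ cong (erase m u ++_) (filter-++ P? (replicate c m) v) ⟩
  erase m u ++ erase m (replicate c m) ++ erase m v
    ≡⟨ cong₂ (λ s t → s ++ erase m (replicate c m) ++ t) (erase-∉ {w = u} (m∉ ∘ ∈-++⁺ˡ)) (erase-∉ {w = v} (m∉ ∘ ∈-++⁺ʳ u)) ⟩
  u ++ erase m (replicate c m) ++ v                     ≡⟨ cong (λ t → u ++ t ++ v) (erase-replicate c m) ⟩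
  u ++ v                                                ∎
  where
    open ≡-Reasoning
    P? = λ x → ¬? (x ≟ m)

-- Multipermutations: words over [n] using every letter exactly c times
-- (c = 1: permutations; c = 2: permutations of the multiset [n]₂).

record Multiperm (c n : ℕ) (w : List ℕ) : Set where
  field
    length≡ : length w ≡ c * n
    letters : All (Letter n) w
    occurs  : ∀ k → k < n → occ (suc k) w ≡ c
open Multiperm

Letter⇒< : ∀ {n a} → Letter n a → a < suc n
Letter⇒< (_ , a≤n) = s≤s a≤n

top∉ : ∀ {n w} → All (Letter n) w → suc n ∉ w
top∉ letters top∈ = ℕP.<-irrefl refl (Letter⇒< (All.lookup letters top∈))

Multiperm-insert : ∀ {c n} u v → Multiperm c n (u ++ v) → Multiperm c (suc n) (u ++ replicate c (suc n) ++ v)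
Multiperm-insert {c} {n} u v mp = record
  { length≡ = begin
      length (u ++ block ++ v)  ≡⟨ additive-insertion length (λ s t → length-++ s) u block v ⟩
      length block + length (u ++ v) ≡⟨ cong₂ _+_ (length-replicate c) (length≡ mp) ⟩
      c + c * n                 ≡⟨ sym (ℕP.*-suc c n) ⟩
      c * suc n                 ∎
  ; letters = AllP.++⁺ (AllP.++⁻ˡ u weakened) (AllP.++⁺ (AllP.replicate⁺ c (s≤s z≤n , ℕP.≤-refl)) (AllP.++⁻ʳ u weakened))
  ; occurs  = occurs′
  }
  where
    open ≡-Reasoning
    block = replicate c (suc n)
    weakened : All (Letter (suc n)) (u ++ v)
    weakened = All.map (λ (1≤a , a≤n) → 1≤a , ℕP.m≤n⇒m≤1+n a≤n) (letters mp)
    occurs′ : ∀ k → k < suc n → occ (suc k) (u ++ block ++ v) ≡ c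
    occurs′ k k<1+n rewrite additive-insertion (occ (suc k)) (occ-++ (suc k)) u block v
      with ℕP.m<1+n⇒m<n∨m≡n k<1+n
    ... | inj₁ k<n  = cong₂ _+_ (occ-replicate-other c (λ eq → ℕP.<⇒≢ k<n (ℕP.suc-injective eq))) (occurs mp k k<n)
    ... | inj₂ refl = trans (cong₂ _+_ (occ-replicate c (suc n)) (∉⇒occ≡0 (u ++ v) (top∉ (letters mp))))
                            (ℕP.+-identityʳ c)

Multiperm-erase : ∀ {c n z} → Multiperm c (suc n) z → Multiperm c n (erase (suc n) z)
Multiperm-erase {c} {n} {z} mp = record
  { length≡ = ℕP.+-cancelʳ-≡ c _ _ (begin
      length (erase (suc n) z) + c              ≡⟨ cong (length (erase (suc n) z) +_) (sym (occurs mp n ℕP.≤-refl)) ⟩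
      length (erase (suc n) z) + occ (suc n) z  ≡⟨ length-erase (suc n) z ⟩
      length z                                  ≡⟨ length≡ mp ⟩
      c * suc n                                 ≡⟨ ℕP.*-suc c n ⟩
      c + c * n                                 ≡⟨ ℕP.+-comm c (c * n) ⟩
      c * n + c                                 ∎)
  ; letters = All.zipWith lower (AllP.filter⁺ P? (letters mp) , AllP.all-filter P? z)
  ; occurs  = λ k k<n → trans (occ-erase z (λ eq → ℕP.<⇒≢ k<n (ℕP.suc-injective eq))) (occurs mp k (ℕP.m≤n⇒m≤1+n k<n))
  }
  where
    open ≡-Reasoning
    P? = λ x → ¬? (x ≟ suc n)
    lower : ∀ {a} → Letter (suc n) a × a ≢ suc n → Letter n a
    lower ((1≤a , a≤1+n) , a≢1+n) = 1≤a , ℕP.m<1+n⇒m≤n (ℕP.≤∧≢⇒< a≤1+n a≢1+n)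

-- The Stirling condition under erasure and insertion of the largest letter

Below : ℕ → List ℕ → Set
Below m = All (_< m)

AboveUntil-∉ : ∀ {x} w → x ∉ w → AboveUntil x w
AboveUntil-∉ []      _   = tt
AboveUntil-∉ (y ∷ w) x∉w = (λ x∈w → ⊥-elim (x∉w (there x∈w))) , AboveUntil-∉ w (x∉w ∘ there)

-- Erasing a letter keeps the Stirling condition: it never puts a new entry
-- between two copies of a letter.
AboveUntil-erase : ∀ {x m} w → AboveUntil x w → AboveUntil x (erase m w)
AboveUntil-erase []              _ = tt
AboveUntil-erase {x} {m} (y ∷ w) (above , rest) with y ≟ m
... | yes refl rewrite erase-drop m w = AboveUntil-erase w rest
... | no y≢m   rewrite erase-keep w y≢m = above ∘ proj₁ ∘ ∈-erase⁻ w , AboveUntil-erase w rest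

Stirlingʳ-erase : ∀ {m} w → Stirlingʳ w → Stirlingʳ (erase m w)
Stirlingʳ-erase []          _ = tt
Stirlingʳ-erase {m} (y ∷ w) (above , rest) with y ≟ m
... | yes refl rewrite erase-drop m w = Stirlingʳ-erase w rest
... | no y≢m   rewrite erase-keep w y≢m = AboveUntil-erase w above , Stirlingʳ-erase w rest

Stirlingʳ-suffix : ∀ u {v} → Stirlingʳ (u ++ v) → Stirlingʳ v
Stirlingʳ-suffix []      s        = s
Stirlingʳ-suffix (_ ∷ u) (_ , s) = Stirlingʳ-suffix u s

∈-skip-block : ∀ {y : ℕ} (u b : List ℕ) {v : List ℕ} → y ∈ u ++ b ++ v → y ∉ b → y ∈ u ++ v
∈-skip-block {y} u b {v} y∈ y∉b with ∈-++⁻ u y∈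
... | inj₁ y∈u = ∈-++⁺ˡ y∈u
... | inj₂ y∈bv with ∈-++⁻ b y∈bv
...   | inj₁ y∈b = ⊥-elim (y∉b y∈b)
...   | inj₂ y∈v = ∈-++⁺ʳ u y∈v

-- The plateau m m is above every smaller letter x, so it may stand between copies of x.
AboveUntil-insert-plateau : ∀ {x m} u v → x < m → AboveUntil x (u ++ v) → AboveUntil x (u ++ m ∷ m ∷ v)
AboveUntil-insert-plateau []      v x<m a = (λ _ → x<m) , (λ _ → x<m) , a
AboveUntil-insert-plateau {x} {m} (y ∷ u) v x<m (above , rest) =
  (λ x∈ → above (∈-skip-block u (m ∷ m ∷ []) x∈ x∉mm)) , AboveUntil-insert-plateau u v x<m rest
  where
    x∉mm : x ∉ m ∷ m ∷ []
    x∉mm (here refl)         = ℕP.<-irrefl refl x<m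
    x∉mm (there (here refl)) = ℕP.<-irrefl refl x<m

Stirlingʳ-insert-plateau : ∀ {m} u v → Below m (u ++ v) → Stirlingʳ (u ++ v) → Stirlingʳ (u ++ m ∷ m ∷ v)
Stirlingʳ-insert-plateau {m} [] v below s = ((λ m∈v → ⊥-elim (m∉v m∈v)) , AboveUntil-∉ v m∉v) , AboveUntil-∉ v m∉v , s
  where
    m∉v : m ∉ v
    m∉v m∈v = ℕP.<-irrefl refl (All.lookup below m∈v)
Stirlingʳ-insert-plateau (y ∷ u) v (y<m ∷ below) (above , s) =
  AboveUntil-insert-plateau u v y<m above , Stirlingʳ-insert-plateau u v below s

occ≡suc⇒∈ : ∀ {m k} w → occ m w ≡ suc k → m ∈ w
occ≡suc⇒∈ {m} (x ∷ w) occ≡ with x ≡ᵇ m in eq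
... | true  = here (sym (ℕP.≡ᵇ⇒≡ x m (subst T (sym eq) tt)))
... | false = there (occ≡suc⇒∈ w occ≡)

split-first : ∀ {m} w → m ∈ w → ∃₂ λ u v → w ≡ u ++ m ∷ v × m ∉ u
split-first {m} (x ∷ w) m∈ with x ≟ m | m∈
... | yes refl | _           = [] , w , refl , λ ()
... | no x≢m   | here m≡x    = ⊥-elim (x≢m (sym m≡x))
... | no x≢m   | there m∈w with split-first w m∈w
...   | u , v , refl , m∉u = x ∷ u , v , refl , λ { (here m≡x) → x≢m (sym m≡x) ; (there m∈u) → m∉u m∈u }

occ-after-first : ∀ {m} u v → m ∉ u → occ m (u ++ m ∷ v) ≡ suc (occ m v)
occ-after-first {m} u v m∉u rewrite occ-++ m u (m ∷ v) | ∉⇒occ≡0 u m∉u | ≡ᵇ-refl m = refl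

∉-++⁺ : ∀ {m : ℕ} u {v} → m ∉ u → m ∉ v → m ∉ u ++ v
∉-++⁺ u m∉u m∉v m∈ with ∈-++⁻ u m∈
... | inj₁ m∈u = m∉u m∈u
... | inj₂ m∈v = m∉v m∈v

single-split : ∀ {m} z → occ m z ≡ 1 → ∃₂ λ u v → z ≡ u ++ m ∷ v × m ∉ u ++ v
single-split {m} z once with split-first z (occ≡suc⇒∈ z once)
... | u , v , refl , m∉u =
  u , v , refl , ∉-++⁺ u m∉u (occ≡0⇒∉ v (ℕP.suc-injective (trans (sym (occ-after-first u v m∉u)) once)))

next-copy : ∀ {m} v → All (_≤ m) v → AboveUntil m v → occ m v ≡ 1 → ∃ λ v′ → v ≡ m ∷ v′ × m ∉ v′
next-copy {m} (y ∷ v′) (y≤m ∷ _) (m∈v′⇒m<y , _) once with y ≟ m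
... | yes refl = v′ , refl , occ≡0⇒∉ v′ (ℕP.suc-injective (trans (cong (_+ occ m v′) (cong ind (sym (≡ᵇ-refl m)))) once))
... | no y≢m   = ⊥-elim (ℕP.<⇒≱ (m∈v′⇒m<y m∈v′) y≤m)
  where
    m∈v′ : m ∈ v′
    m∈v′ with occ≡suc⇒∈ (y ∷ v′) once
    ... | here m≡y   = ⊥-elim (y≢m (sym m≡y))
    ... | there m∈v′ = m∈v′

plateau-split : ∀ {m} z → All (_≤ m) z → Stirlingʳ z → occ m z ≡ 2 →
                ∃₂ λ u v → z ≡ u ++ m ∷ m ∷ v × m ∉ u ++ v
plateau-split {m} z bounded stirling twice with split-first z (occ≡suc⇒∈ z twice)
... | u , v , refl , m∉u with next-copy v (All.tail (AllP.++⁻ʳ u bounded))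
                                   (proj₁ (Stirlingʳ-suffix u stirling))
                                   (ℕP.suc-injective (trans (sym (occ-after-first u v m∉u)) twice))
...   | v′ , refl , m∉v′ = u , v′ , refl , ∉-++⁺ u m∉u m∉v′

occurs-fromFin : ∀ {n c w} → ((i : Fin n) → occ (suc (F.toℕ i)) w ≡ c) → ∀ k → k < n → occ (suc k) w ≡ c
occurs-fromFin {w = w} h k k<n = subst (λ t → occ (suc t) w ≡ _) (FP.toℕ-fromℕ< k<n) (h (F.fromℕ< k<n))

occurs-toFin : ∀ {n c w} → (∀ k → k < n → occ (suc k) w ≡ c) → (i : Fin n) → occ (suc (F.toℕ i)) w ≡ c
occurs-toFin h i = h (F.toℕ i) (FP.toℕ<n i)

Sym⁻ : ∀ n {w} → w ∈ Sym n → Multiperm 1 n w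
Sym⁻ n {w} w∈ with ∈-filter⁻ (IsPerm? n) w∈
... | w∈words , perm with words⁻ n n w∈words
...   | len , letters = record
  { length≡ = trans len (sym (ℕP.*-identityˡ n)) ; letters = letters ; occurs = occurs-fromFin {w = w} perm }

Sym⁺ : ∀ n {w} → Multiperm 1 n w → w ∈ Sym n
Sym⁺ n {w} mp = ∈-filter⁺ (IsPerm? n)
  (subst (λ t → w ∈ words t n) (trans (length≡ mp) (ℕP.*-identityˡ n)) (words⁺ n (letters mp)))
  (occurs-toFin {w = w} (occurs mp))

record CyclicStirling (n : ℕ) (w : List ℕ) : Set where
  field
    multiperm : Multiperm 2 n w
    stirling  : Stirlingʳ w
    first     : FirstIsOne w
open CyclicStirling

CQ? : ∀ n w → Dec (IsPerm2 n w × Stirling w × FirstIsOne w)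
CQ? n w = IsPerm2? n w ×-dec (Stirling? w ×-dec FirstIsOne? w)

CQ⁻ : ∀ n {w} → w ∈ CQ n → CyclicStirling n w
CQ⁻ n {w} w∈ with ∈-filter⁻ (CQ? n) w∈
... | w∈words , perm2 , stir , first with words⁻ (2 * n) n w∈words
...   | len , letters = record
  { multiperm = record { length≡ = len ; letters = letters ; occurs = occurs-fromFin {w = w} perm2 }
  ; stirling  = Stirling⇒Stirlingʳ w stir
  ; first     = first
  }

CQ⁺ : ∀ n {w} → CyclicStirling n w → w ∈ CQ n
CQ⁺ n {w} cs = ∈-filter⁺ (CQ? n)
  (subst (λ t → w ∈ words t n) (length≡ (multiperm cs)) (words⁺ n (letters (multiperm cs))))
  (occurs-toFin {w = w} (occurs (multiperm cs)) , Stirlingʳ⇒Stirling w (stirling cs) , first cs)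

Sym-unique : ∀ n → Unique (Sym n)
Sym-unique n = Unique.filter⁺ (IsPerm? n) (words-unique n n)

CQ-unique : ∀ n → Unique (CQ n)
CQ-unique n = Unique.filter⁺ (CQ? n) (words-unique (2 * n) n)

-- Insertion of the plateau m m right after one of the entries of a cycle
-- (c₁, …); inserting before c₁ is excluded since cycles start with 1.
plateauInsertions : ℕ → List ℕ → List (List ℕ)
plateauInsertions m []      = []
plateauInsertions m (x ∷ τ) = map (x ∷_) (insertions (m ∷ m ∷ []) τ)

plateauInsertions-unique : ∀ {m} τ → m ∉ τ → Unique (plateauInsertions m τ)
plateauInsertions-unique []      _   = []
plateauInsertions-unique (x ∷ τ) m∉ = Unique.map⁺ ∷-injectiveʳ (insertions-unique (_ ∷ []) τ (m∉ ∘ there))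

below-top : ∀ {n w} → All (Letter n) w → Below (suc n) w
below-top = All.map Letter⇒<

CQ-into : ∀ n {τ z} → τ ∈ CQ n → z ∈ plateauInsertions (suc n) τ → erase (suc n) z ≡ τ × z ∈ CQ (suc n)
CQ-into n {x ∷ τ} τ∈ z∈ with CQ⁻ n τ∈ | ∈-map⁻ (x ∷_) z∈
... | cs | z′ , z′∈ , refl with insertions⁻ _ τ z′∈
...   | u , v , refl , refl =
  erase-insertion 2 (suc n) (x ∷ u) v (top∉ (letters (multiperm cs))) ,
  CQ⁺ (suc n) record
    { multiperm = Multiperm-insert (x ∷ u) v (multiperm cs)
    ; stirling  = Stirlingʳ-insert-plateau (x ∷ u) v (below-top (letters (multiperm cs))) (stirling cs)
    ; first     = first cs
    }

-- Conversely, erasing n + 1 from σ ∈ 𝒞𝒬_{n+1} gives τ ∈ 𝒞𝒬_n with σ a plateau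
-- insertion into τ; n ≥ 1 guarantees that the leading 1 is not erased.
CQ-onto : ∀ n → 1 ≤ n → ∀ {z} → z ∈ CQ (suc n) →
          erase (suc n) z ∈ CQ n × z ∈ plateauInsertions (suc n) (erase (suc n) z)
CQ-onto n 1≤n {z} z∈ with CQ⁻ (suc n) z∈
... | cs with plateau-split z (All.map proj₂ (letters (multiperm cs))) (stirling cs) (occurs (multiperm cs) n ℕP.≤-refl)
...   | [] , v , refl , _ = ⊥-elim (ℕP.<⇒≢ 1≤n (sym (ℕP.suc-injective (first cs))))
...   | x ∷ u , v , refl , m∉ rewrite erase-insertion 2 (suc n) (x ∷ u) v m∉ =
  CQ⁺ n record
    { multiperm = subst (Multiperm 2 n) erased (Multiperm-erase (multiperm cs))
    ; stirling  = subst Stirlingʳ erased (Stirlingʳ-erase z (stirling cs))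
    ; first     = first cs
    } ,
  ∈-map⁺ (x ∷_) (insertions⁺ _ u v)
  where
    erased : erase (suc n) z ≡ x ∷ u ++ v
    erased = erase-insertion 2 (suc n) (x ∷ u) v m∉

Sym-into : ∀ n {π z} → π ∈ Sym n → z ∈ insertions (suc n ∷ []) π → erase (suc n) z ≡ π × z ∈ Sym (suc n)
Sym-into n {π} π∈ z∈ with Sym⁻ n π∈ | insertions⁻ _ π z∈
... | mp | u , v , refl , refl =
  erase-insertion 1 (suc n) u v (top∉ (letters mp)) , Sym⁺ (suc n) (Multiperm-insert u v mp)

Sym-onto : ∀ n {z} → z ∈ Sym (suc n) → erase (suc n) z ∈ Sym n × z ∈ insertions (suc n ∷ []) (erase (suc n) z)
Sym-onto n {z} z∈ with Sym⁻ (suc n) z∈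
... | mp with single-split z (occurs mp n ℕP.≤-refl)
...   | u , v , refl , m∉ rewrite erase-insertion 1 (suc n) u v m∉ =
  Sym⁺ n (subst (Multiperm 1 n) (erase-insertion 1 (suc n) u v m∉) (Multiperm-erase mp)) ,
  insertions⁺ _ u v

CQ-↭ : ∀ n → 1 ≤ n → CQ (suc n) ↭ concatMap (plateauInsertions (suc n)) (CQ n)
CQ-↭ n 1≤n = fibres-↭ (plateauInsertions (suc n)) (erase (suc n)) (CQ-unique n) (CQ-unique (suc n))
  (λ {τ} τ∈ → plateauInsertions-unique τ (top∉ (letters (multiperm (CQ⁻ n τ∈)))))
  (CQ-into n) (CQ-onto n 1≤n)

Sym-↭ : ∀ n → Sym (suc n) ↭ concatMap (insertions (suc n ∷ [])) (Sym n)
Sym-↭ n = fibres-↭ (insertions (suc n ∷ [])) (erase (suc n)) (Sym-unique n) (Sym-unique (suc n))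
  (λ {π} π∈ → insertions-unique [] π (top∉ (letters (Sym⁻ n π∈))))
  (Sym-into n) (Sym-onto n)

<ᵇ-true : ∀ {x y} → x < y → (x <ᵇ y) ≡ true
<ᵇ-true {x} {y} x<y with x <ᵇ y in eq
... | true  = refl
... | false = ⊥-elim (subst T eq (ℕP.<⇒<ᵇ x<y))

<ᵇ-false : ∀ {x y} → ¬ x < y → (x <ᵇ y) ≡ false
<ᵇ-false {x} {y} x≮y with x <ᵇ y in eq
... | true  = ⊥-elim (x≮y (ℕP.<ᵇ⇒< x y (subst T (sym eq) tt)))
... | false = refl

bump-first : ∀ q c → suc c ≡ bump (ind q + c) q
bump-first true  c = refl
bump-first false c = refl

bump-merge : ∀ q f c → (q ≡ true → f ≡ false) → bump c f ≡ bump (ind q + c) (q ∨ f)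
bump-merge true  f c excl rewrite excl refl = refl
bump-merge false f c _    = refl

bump-shift : ∀ q c f → ind q + bump c f ≡ bump (ind q + c) f
bump-shift q c true  = refl
bump-shift q c false = ℕP.+-suc (ind q) c

-- Cycle ascent plateaus under plateau insertion

plateauAfter : ℕ → List ℕ → Bool
plateauAfter x (y ∷ z ∷ _) = (x <ᵇ y) ∧ (y ≡ᵇ z)
plateauAfter x _           = false

cap-cons : ∀ x w → cap (x ∷ w) ≡ ind (plateauAfter x w) + cap w
cap-cons x []          = refl
cap-cons x (y ∷ [])    = refl
cap-cons x (y ∷ z ∷ r) = refl

-- Consecutive entries cannot both start a plateau: in x < y = z, z < z fails.
plateauAfter-exclusive : ∀ x y r → plateauAfter x (y ∷ r) ≡ true → plateauAfter y r ≡ false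
plateauAfter-exclusive x y (z ∷ [])    _ = refl
plateauAfter-exclusive x y (z ∷ u ∷ r) h with y ≟ z
... | yes refl rewrite <ᵇ-false (ℕP.<-irrefl {y} refl) = refl
... | no y≢z   rewrite ≢⇒≡ᵇ-false y≢z | ∧-zeroʳ (x <ᵇ y) with h
...   | ()

-- Inserting the plateau m m right after y creates exactly one plateau and
-- shields the first entry of w from being one.
cap-plateau-after : ∀ {m} y w → y < m → Below m w → cap (y ∷ m ∷ m ∷ w) ≡ suc (cap w)
cap-plateau-after {m} y []          y<m _ rewrite <ᵇ-true y<m | ≡ᵇ-refl m = refl
cap-plateau-after {m} y (z ∷ [])    y<m _ rewrite <ᵇ-true y<m | ≡ᵇ-refl m | <ᵇ-false (ℕP.<-irrefl {m} refl) = refl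
cap-plateau-after {m} y (z ∷ u ∷ w) y<m (z<m ∷ _)
  rewrite <ᵇ-true y<m | ≡ᵇ-refl m | <ᵇ-false (ℕP.<-irrefl {m} refl) | <ᵇ-false (ℕP.<⇒≯ z<m) = refl

-- The flags of the plateau insertions into the cycle y r (one per entry, the
-- insertion going right after it).  An insertion keeps the number of plateaus
-- iff it splits an existing plateau c_{i-1} < c_i = c_{i+1} or c_i < c_{i+1} = c_{i+2}.
laterPlateauFlags : ℕ → List ℕ → List Bool
laterPlateauFlags y []      = []
laterPlateauFlags y (z ∷ r) = (plateauAfter y (z ∷ r) ∨ plateauAfter z r) ∷ laterPlateauFlags z r

plateauFlags : List ℕ → List Bool
plateauFlags []      = []
plateauFlags (y ∷ r) = plateauAfter y r ∷ laterPlateauFlags y r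

map-bump-shift : ∀ q c fl → map (ind q +_) (map (bump c) fl) ≡ map (bump (ind q + c)) fl
map-bump-shift q c fl = trans (sym (map-∘ fl)) (map-cong (bump-shift q c) fl)

cap-prefix : ∀ y z u (ws : List (List ℕ)) →
             map cap (map (y ∷_) (map (z ∷_) (map (u ∷_) ws))) ≡
             map (ind (plateauAfter y (z ∷ u ∷ [])) +_) (map cap (map (z ∷_) (map (u ∷_) ws)))
cap-prefix y z u []       = refl
cap-prefix y z u (w ∷ ws) = cong (_ ∷_) (cap-prefix y z u ws)

cap-plateau-second : ∀ {m} y z r → z < m → cap (y ∷ z ∷ m ∷ m ∷ r) ≡ cap (z ∷ m ∷ m ∷ r)
cap-plateau-second {m} y z r z<m rewrite ≢⇒≡ᵇ-false (ℕP.<⇒≢ z<m) | ∧-zeroʳ (y <ᵇ z) = refl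

plateau-insertions-head : ∀ m r → insertions (m ∷ m ∷ []) r ≡ (m ∷ m ∷ r) ∷ drop 1 (insertions (m ∷ m ∷ []) r)
plateau-insertions-head m []      = refl
plateau-insertions-head m (_ ∷ _) = refl

cap-plateauInsertions : ∀ {m} y r → Below m (y ∷ r) →
  map cap (plateauInsertions m (y ∷ r)) ≡ map (bump (cap (y ∷ r))) (plateauFlags (y ∷ r))
cap-plateauInsertions {m} y []      (y<m ∷ _) rewrite <ᵇ-true y<m | ≡ᵇ-refl m = refl
cap-plateauInsertions {m} y (z ∷ r) (y<m ∷ z<m ∷ below)
  rewrite cap-cons y (z ∷ r) | plateau-insertions-head m r =
  cong₂ _∷_ after-y (cong₂ _∷_ after-z (later r (∷-injectiveʳ ih)))
  where
    c = cap (z ∷ r)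
    q = plateauAfter y (z ∷ r)
    ih : cap (z ∷ m ∷ m ∷ r) ∷ map cap (map (z ∷_) (drop 1 (insertions (m ∷ m ∷ []) r))) ≡
         bump c (plateauAfter z r) ∷ map (bump c) (laterPlateauFlags z r)
    ih = subst (λ ws → map cap (map (z ∷_) ws) ≡ map (bump c) (plateauFlags (z ∷ r)))
               (plateau-insertions-head m r) (cap-plateauInsertions z r (z<m ∷ below))
    after-y : cap (y ∷ m ∷ m ∷ z ∷ r) ≡ bump (ind q + c) q
    after-y = trans (cap-plateau-after y (z ∷ r) y<m (z<m ∷ below)) (bump-first q c)
    after-z : cap (y ∷ z ∷ m ∷ m ∷ r) ≡ bump (ind q + c) (q ∨ plateauAfter z r)
    after-z = trans (cap-plateau-second y z r z<m)
                    (trans (∷-injectiveˡ ih) (bump-merge q (plateauAfter z r) c (plateauAfter-exclusive y z r)))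
    later : ∀ r → map cap (map (z ∷_) (drop 1 (insertions (m ∷ m ∷ []) r))) ≡ map (bump c) (laterPlateauFlags z r) →
            map cap (map (y ∷_) (map (z ∷_) (drop 1 (insertions (m ∷ m ∷ []) r)))) ≡
            map (bump (ind (plateauAfter y (z ∷ r)) + c)) (laterPlateauFlags z r)
    later []      _  = refl
    later (u ∷ r) eq = trans (cap-prefix y z u _) (trans (cong (map (ind (plateauAfter y (z ∷ u ∷ [])) +_)) eq)
                                                         (map-bump-shift _ c (laterPlateauFlags z (u ∷ r))))

-- Each plateau c_{i-1} < c_i = c_{i+1} is split by exactly two insertions
-- (after c_{i-1} and after c_i), so 2·cap insertions keep cap.
trues-plateauFlags : ∀ y r → trues (plateauFlags (y ∷ r)) ≡ cap (y ∷ r) + cap (y ∷ r)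
trues-plateauFlags y []      = refl
trues-plateauFlags y (z ∷ r) rewrite cap-cons y (z ∷ r) =
  two-gaps (plateauAfter y (z ∷ r)) (plateauAfter z r) (plateauAfter-exclusive y z r) (trues-plateauFlags z r)
  where
    two-gaps : ∀ q f {t c} → (q ≡ true → f ≡ false) → ind f + t ≡ c + c →
               ind q + (ind (q ∨ f) + t) ≡ (ind q + c) + (ind q + c)
    two-gaps true  f {t} {c} excl ih rewrite excl refl = cong suc (trans (cong suc ih) (sym (ℕP.+-suc c c)))
    two-gaps false f         _    ih = ih

length-laterPlateauFlags : ∀ y r → length (laterPlateauFlags y r) ≡ length r
length-laterPlateauFlags y []      = refl
length-laterPlateauFlags y (z ∷ r) = cong suc (length-laterPlateauFlags z r)

length-plateauFlags : ∀ τ → length (plateauFlags τ) ≡ length τ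
length-plateauFlags []      = refl
length-plateauFlags (y ∷ r) = cong suc (length-laterPlateauFlags y r)

-- Descents under insertion of a largest letter

-- The flags of the insertions of m into the gaps of π, from left to right:
-- inserting in front raises des, inserting into a descent or at the end keeps it,
-- inserting into an ascent raises it.
laterDescentFlags : ℕ → List ℕ → List Bool
laterDescentFlags x []      = true ∷ []
laterDescentFlags x (y ∷ π) = (y <ᵇ x) ∷ laterDescentFlags y π

descentFlags : List ℕ → List Bool
descentFlags []      = true ∷ []
descentFlags (x ∷ π) = false ∷ laterDescentFlags x π

des-prefix : ∀ x y (ws : List (List ℕ)) →
             map (λ w → des (x ∷ w)) (map (y ∷_) ws) ≡ map (ind (y <ᵇ x) +_) (map (λ w → des (y ∷ w)) ws)
des-prefix x y []       = refl
des-prefix x y (w ∷ ws) = cong (_ ∷_) (des-prefix x y ws)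

des-prefixed-insertions : ∀ {m} x π → x < m → Below m π →
  map (λ w → des (x ∷ w)) (insertions (m ∷ []) π) ≡ map (bump (des (x ∷ π))) (laterDescentFlags x π)
des-prefixed-insertions x []      x<m _ rewrite <ᵇ-false (ℕP.<⇒≯ x<m) = refl
des-prefixed-insertions {m} x (y ∷ π) x<m (y<m ∷ below) rewrite <ᵇ-false (ℕP.<⇒≯ x<m) | <ᵇ-true y<m =
  cong₂ _∷_ (bump-first (y <ᵇ x) (des (y ∷ π))) (begin
    map (λ w → des (x ∷ w)) (map (y ∷_) (insertions (m ∷ []) π))
      ≡⟨ des-prefix x y _ ⟩
    map (ind (y <ᵇ x) +_) (map (λ w → des (y ∷ w)) (insertions (m ∷ []) π))
      ≡⟨ cong (map (ind (y <ᵇ x) +_)) (des-prefixed-insertions y π y<m below) ⟩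
    map (ind (y <ᵇ x) +_) (map (bump (des (y ∷ π))) (laterDescentFlags y π))
      ≡⟨ map-bump-shift (y <ᵇ x) (des (y ∷ π)) _ ⟩
    map (bump (ind (y <ᵇ x) + des (y ∷ π))) (laterDescentFlags y π) ∎)
  where open ≡-Reasoning

des-insertions : ∀ {m} π → Below m π → map des (insertions (m ∷ []) π) ≡ map (bump (des π)) (descentFlags π)
des-insertions []      _               = refl
des-insertions {m} (x ∷ π) (x<m ∷ below) rewrite <ᵇ-true x<m =
  cong (suc (des (x ∷ π)) ∷_) (trans (sym (map-∘ (insertions (m ∷ []) π))) (des-prefixed-insertions x π x<m below))

-- des π + 1 of the insertions keep des: the end and the des π descents.
trues-laterDescentFlags : ∀ x π → trues (laterDescentFlags x π) ≡ suc (des (x ∷ π))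
trues-laterDescentFlags x []      = refl
trues-laterDescentFlags x (y ∷ π) = trans (cong (ind (y <ᵇ x) +_) (trues-laterDescentFlags y π)) (ℕP.+-suc _ _)

trues-descentFlags : ∀ π → trues (descentFlags π) ≡ suc (des π)
trues-descentFlags []      = refl
trues-descentFlags (x ∷ π) = trues-laterDescentFlags x π

length-laterDescentFlags : ∀ x π → length (laterDescentFlags x π) ≡ suc (length π)
length-laterDescentFlags x []      = refl
length-laterDescentFlags x (y ∷ π) = cong suc (length-laterDescentFlags y π)

length-descentFlags : ∀ π → length (descentFlags π) ≡ suc (length π)
length-descentFlags []      = refl
length-descentFlags (x ∷ π) = cong suc (length-laterDescentFlags x π)

-- The recurrences for Y and A

Y-countAt : ∀ n j → Y n j ≡ countAt cap j (CQ n)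
Y-countAt n j = length-filter (λ w → cap w ≟ j) (CQ n)

A-countAt : ∀ n j → A n j ≡ countAt des j (Sym n)
A-countAt n j = length-filter (λ w → des w ≟ j) (Sym n)

CQ-fibre-cap : ∀ n {τ} → τ ∈ CQ n → map cap (plateauInsertions (suc n) τ) ≡ map (bump (cap τ)) (plateauFlags τ)
CQ-fibre-cap n {τ} τ∈ with τ | CQ⁻ n τ∈
... | y ∷ r | cs = cap-plateauInsertions y r (below-top (letters (multiperm cs)))

CQ-fibre-trues : ∀ n {τ} → τ ∈ CQ n → trues (plateauFlags τ) ≡ cap τ + cap τ
CQ-fibre-trues n {τ} τ∈ with τ | CQ⁻ n τ∈
... | y ∷ r | _ = trues-plateauFlags y r

CQ-fibre-length : ∀ n {τ} → τ ∈ CQ n → length (plateauFlags τ) ≡ 2 * n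
CQ-fibre-length n {τ} τ∈ = trans (length-plateauFlags τ) (length≡ (multiperm (CQ⁻ n τ∈)))

module CapRecurrence (n : ℕ) (1≤n : 1 ≤ n) = InsertionRecurrence
  cap (λ c → c + c) (2 * n) (CQ n) (CQ (suc n)) (plateauInsertions (suc n)) plateauFlags
  (CQ-↭ n 1≤n) (CQ-fibre-cap n) (CQ-fibre-trues n) (CQ-fibre-length n)

module DesRecurrence (n : ℕ) = InsertionRecurrence
  des suc (suc n) (Sym n) (Sym (suc n)) (insertions (suc n ∷ [])) descentFlags
  (Sym-↭ n)
  (λ {π} π∈ → des-insertions π (below-top (letters (Sym⁻ n π∈))))
  (λ {π} _ → trues-descentFlags π)
  (λ {π} π∈ → trans (length-descentFlags π) (cong suc (trans (length≡ (Sym⁻ n π∈)) (ℕP.*-identityˡ n))))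

Y-zero : ∀ n → 1 ≤ n → Y (suc n) 0 ≡ 0
Y-zero n 1≤n = trans (Y-countAt (suc n) 0) (CapRecurrence.recurrence-zero n 1≤n)

Y-suc : ∀ n → 1 ≤ n → ∀ k → Y (suc n) (suc k) ≡ (suc k + suc k) * Y n (suc k) + (2 * n ∸ (k + k)) * Y n k
Y-suc n 1≤n k rewrite Y-countAt (suc n) (suc k) | Y-countAt n (suc k) | Y-countAt n k =
  CapRecurrence.recurrence-suc n 1≤n k

A-zero : ∀ n → A (suc n) 0 ≡ A n 0
A-zero n rewrite A-countAt (suc n) 0 | A-countAt n 0 =
  trans (DesRecurrence.recurrence-zero n) (ℕP.*-identityˡ _)

A-suc : ∀ n k → A (suc n) (suc k) ≡ suc (suc k) * A n (suc k) + (n ∸ k) * A n k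
A-suc n k rewrite A-countAt (suc n) (suc k) | A-countAt n (suc k) | A-countAt n k =
  DesRecurrence.recurrence-suc n k

-- The base case n = 1: 𝒞𝒬_2 = {1122, 1221}, both with one plateau.
Y-shifted-base : ∀ j → Y 2 (suc j) ≡ 2 ^ 1 * A 1 j
Y-shifted-base zero    = refl
Y-shifted-base (suc j) = refl

Y-shifted-step : ∀ n → 1 ≤ n → (∀ j → Y (suc n) (suc j) ≡ 2 ^ n * A n j) →
                 ∀ j → Y (suc (suc n)) (suc j) ≡ 2 ^ suc n * A (suc n) j
Y-shifted-step n 1≤n ih zero = begin
  Y (suc (suc n)) 1                                             ≡⟨ Y-suc (suc n) (s≤s z≤n) 0 ⟩
  2 * Y (suc n) 1 + 2 * suc n * Y (suc n) 0                    ≡⟨ cong₂ (λ a b → 2 * a + 2 * suc n * b) (ih 0) (Y-zero n 1≤n) ⟩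
  2 * (2 ^ n * A n 0) + 2 * suc n * 0                          ≡⟨ arith (2 ^ n) (A n 0) (2 * suc n) ⟩
  2 ^ suc n * A n 0                                             ≡⟨ cong (2 ^ suc n *_) (sym (A-zero n)) ⟩
  2 ^ suc n * A (suc n) 0                                       ∎
  where
    open ≡-Reasoning
    arith : ∀ p a b → 2 * (p * a) + b * 0 ≡ 2 * p * a
    arith = solve-∀
Y-shifted-step n 1≤n ih (suc k) = begin
  Y (suc (suc n)) (suc (suc k))
    ≡⟨ Y-suc (suc n) (s≤s z≤n) (suc k) ⟩
  (suc (suc k) + suc (suc k)) * Y (suc n) (suc (suc k)) + (2 * suc n ∸ (suc k + suc k)) * Y (suc n) (suc k)
    ≡⟨ cong₂ (λ a b → (suc (suc k) + suc (suc k)) * a + (2 * suc n ∸ (suc k + suc k)) * b) (ih (suc k)) (ih k) ⟩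
  (suc (suc k) + suc (suc k)) * (2 ^ n * A n (suc k)) + (2 * suc n ∸ (suc k + suc k)) * (2 ^ n * A n k)
    ≡⟨ cong (λ t → (suc (suc k) + suc (suc k)) * (2 ^ n * A n (suc k)) + t * (2 ^ n * A n k)) double-gap ⟩
  (suc (suc k) + suc (suc k)) * (2 ^ n * A n (suc k)) + 2 * (n ∸ k) * (2 ^ n * A n k)
    ≡⟨ arith k (n ∸ k) (2 ^ n) (A n (suc k)) (A n k) ⟩
  2 ^ suc n * (suc (suc k) * A n (suc k) + (n ∸ k) * A n k)
    ≡⟨ cong (2 ^ suc n *_) (sym (A-suc n k)) ⟩
  2 ^ suc n * A (suc n) (suc k) ∎
  where
    open ≡-Reasoning
    double-gap : 2 * suc n ∸ (suc k + suc k) ≡ 2 * (n ∸ k)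
    double-gap = trans (cong (2 * suc n ∸_) (twice (suc k))) (sym (ℕP.*-distribˡ-∸ 2 (suc n) (suc k)))
      where
        twice : ∀ a → a + a ≡ 2 * a
        twice = solve-∀
    arith : ∀ k t p a b → (suc (suc k) + suc (suc k)) * (p * a) + 2 * t * (p * b) ≡ 2 * p * (suc (suc k) * a + t * b)
    arith = solve-∀

Y-shifted : ∀ n → 1 ≤ n → ∀ j → Y (suc n) (suc j) ≡ 2 ^ n * A n j
Y-shifted (suc zero)    _ = Y-shifted-base
Y-shifted (suc (suc n)) _ = Y-shifted-step (suc n) (s≤s z≤n) (Y-shifted (suc n) (s≤s z≤n))

corollary13 : (n : ℕ) → 1 ≤ n → (j : ℕ) → Y (suc n) j ≡ ((2 ^ n) ·P (X* A n)) j
corollary13 n 1≤n zero    = trans (Y-zero n 1≤n) (sym (ℕP.*-zeroʳ (2 ^ n)))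
corollary13 n 1≤n (suc j) = Y-shifted n 1≤n j
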